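{- Let $G$ be a finite simple connected factor-critical equimatchable graph, $v$ a vertex of $G$, and $M$ a minimal matching isolating $v$. Then every connected component of $G\setminus V(M)$ other than $\{v\}$ is isomorphic to either $K_{2n}$ or $K_{n,n}$ for some integer $n$.
   Context: $V(M)$ is the set of vertices incident with edges of $M$. $G$ is factor-critical if $G-w$ has a perfect matching for every vertex $w$; $G$ is equimatchable if every maximal matching is maximum. A matching $M$ isolates $v$ if $\{v\}$ is a component of $G\setminus V(M)$, and it is minimal if no proper subset of $M$ isolates $v$. -}

module Defs where

open import Level using (0ℓ)
open import Data.Nat using (ℕ; _≤_; _*_)
open import Data.Fin using (Fin)
open import Data.Product using (Σ; ∃; _×_; _,_; proj₁; proj₂)
open import Data.Sum using (_⊎_)
open import Data.Unit using (⊤)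
open import Data.List using (List; length)
open import Data.List.Relation.Unary.All using (All)
open import Data.List.Relation.Unary.Any using (Any)
open import Data.List.Relation.Unary.AllPairs using (AllPairs)
open import Data.List.Membership.Propositional using (_∈_; _∉_)
open import Relation.Nullary using (¬_; Dec)
open import Relation.Binary.PropositionalEquality using (_≡_; _≢_)

record Graph : Set₁ where
  field
    n     : ℕ
    _~_   : Fin n → Fin n → Set
    sym   : ∀ {x y} → x ~ y → y ~ x
    irrefl : ∀ {x} → ¬ (x ~ x)
    dec   : ∀ x y → Dec (x ~ y)

module _ (G : Graph) where
  open Graph G

  Vtx : Set
  Vtx = Fin n

  Edge : Set
  Edge = Vtx × Vtx

  -- Reach P u w : there is a walk from u to w in G using only vertices satisfying P
  -- (i.e. w lies in the component of u in the subgraph induced by P).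
  data Reach (P : Vtx → Set) : Vtx → Vtx → Set where
    here : ∀ {u} → P u → Reach P u u
    step : ∀ {u x w} → P u → u ~ x → Reach P x w → Reach P u w

  Connected : Set
  Connected = ∀ u w → Reach (λ _ → ⊤) u w

  Covered : List Edge → Vtx → Set
  Covered M w = Any (λ e → proj₁ e ≡ w ⊎ proj₂ e ≡ w) M

  Disjoint : Edge → Edge → Set
  Disjoint (a , b) (c , d) = a ≢ c × a ≢ d × b ≢ c × b ≢ d

  IsMatching : List Edge → Set
  IsMatching M = All (λ e → proj₁ e ~ proj₂ e) M × AllPairs Disjoint M

  IsMaximal : List Edge → Set
  IsMaximal M = IsMatching M × (∀ u w → u ~ w → Covered M u ⊎ Covered M w)

  IsMaximum : List Edge → Set
  IsMaximum M = IsMatching M × (∀ N → IsMatching N → length N ≤ length M)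

  Equimatchable : Set
  Equimatchable = ∀ M → IsMaximal M → IsMaximum M

  FactorCritical : Set
  FactorCritical = ∀ w → Σ (List Edge) λ M →
    IsMatching M × ¬ Covered M w × (∀ u → u ≢ w → Covered M u)

  NotCovered : List Edge → Vtx → Set
  NotCovered M x = ¬ Covered M x

  -- M isolates v : {v} is a component of G \ V(M),
  -- i.e. v ∉ V(M) and every neighbour of v lies in V(M).
  Isolates : List Edge → Vtx → Set
  Isolates M v = ¬ Covered M v × (∀ u → v ~ u → Covered M u)

  ProperSubset : List Edge → List Edge → Set
  ProperSubset N M = (∀ {e} → e ∈ N → e ∈ M) × (Σ Edge λ e → e ∈ M × e ∉ N)

  MinimalIsolating : List Edge → Vtx → Set
  MinimalIsolating M v =
    IsMatching M × Isolates M v × (∀ N → ProperSubset N M → ¬ Isolates N v)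

  -- the subgraph induced on the set C is isomorphic to a graph H on Fin m with
  -- adjacency R: there is an injection f : Fin m → V(G) with image exactly C,
  -- preserving and reflecting adjacency.
  InducedIso : (C : Vtx → Set) (m : ℕ) (R : Fin m → Fin m → Set) → Set
  InducedIso C m R = Σ (Fin m → Vtx) λ f →
    (∀ i j → f i ≡ f j → i ≡ j) ×
    (∀ w → (C w → Σ (Fin m) λ i → f i ≡ w) × (Σ (Fin m) (λ i → f i ≡ w) → C w)) ×
    (∀ i j → (f i ~ f j → R i j) × (R i j → f i ~ f j))

KAdj : (m : ℕ) → Fin m → Fin m → Set
KAdj m i j = i ≢ j

open import Data.Fin using (toℕ)
open import Data.Nat using (_<_)
KBipAdj : (k : ℕ) → Fin (2 * k) → Fin (2 * k) → Set
KBipAdj k i j = (toℕ i < k × ¬ (toℕ j < k)) ⊎ (¬ (toℕ i < k) × toℕ j < k)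

module Submission where

-- Let M be a matching isolating v in a factor-critical equimatchable graph G,
-- and let U be the set of vertices not covered by M.  The proof rests on one
-- counting fact: since G - w has a perfect matching for every w and every
-- maximal matching is maximum, a maximal matching of G leaves at most one
-- vertex exposed.  Extending M plus a matching inside U greedily to a maximal
-- matching, v is always exposed, hence
--   (1) a vertex z ≠ v of U, exposed by a matching L inside U, has a
--       neighbour in U that L also exposes (exposed-neighbour);
--   (2) every path a-b-c-d in U closes up: a ~ d (close-path).
-- By (2) every component C of U - v has diameter at most two, so C is
-- decidable, and by (1) a maximal matching P of C is perfect.  If C is a
-- clique, listing the endpoints of P gives K_{2k}.  Otherwise pick x, z ∈ C
-- non-adjacent; (2) shows that C is complete bipartite with sides
-- "non-neighbours of x" and "neighbours of x", each edge of P has one end on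
-- each side, and listing first the far ends, then the near ends gives K_{k,k}.

open import Defs
open import Data.Nat using (ℕ; _*_)
open import Data.Product using (Σ; _×_)
open import Data.Sum using (_⊎_)
open import Relation.Nullary using (¬_)
open import Relation.Binary.PropositionalEquality using (_≢_)

open import Data.Nat using (_+_; _≤_; _<_; _<?_; s≤s; z≤n)
import Data.Nat.Properties as ℕP
open import Data.Fin using (Fin; zero; suc; toℕ; _≟_)
import Data.Fin.Properties as FinP
open import Data.Product using (_,_; proj₁; proj₂; swap)
open import Data.Sum using (inj₁; inj₂; [_,_]′)
import Data.Sum as Sum
open import Data.Empty using (⊥; ⊥-elim)
open import Function using (id; _∘_)
open import Data.List using (List; []; _∷_; _++_; length; map; foldr; allFin; cartesianProduct)
open import Data.List.Properties using (length-map; length-++)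
open import Data.List.Relation.Unary.All as All using (All; []; _∷_)
import Data.List.Relation.Unary.All.Properties as AllP
open import Data.List.Relation.Unary.Any as Any using (Any; here; there)
import Data.List.Relation.Unary.Any.Properties as AnyP
open import Data.List.Relation.Unary.AllPairs as AllPairs using (AllPairs; []; _∷_)
import Data.List.Relation.Unary.AllPairs.Properties as AllPairsP
open import Data.List.Membership.Propositional using (_∈_; find; lose)
open import Data.List.Membership.Propositional.Properties using (∈-cartesianProduct⁺; ∈-allFin)
open import Data.List.Membership.Setoid.Properties using (index-injective)
open import Relation.Nullary using (Dec; yes; no)
open import Relation.Nullary.Decidable using (_×-dec_; _⊎-dec_; ¬?)
open import Relation.Binary.PropositionalEquality
  using (_≡_; refl; sym; cong; cong₂; subst; setoid; module ≡-Reasoning)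

lookupAt : ∀ {A : Set} (xs : List A) {m : ℕ} → length xs ≡ m → Fin m → A
lookupAt (x ∷ xs) refl zero    = x
lookupAt (x ∷ xs) refl (suc i) = lookupAt xs refl i

lookupAt-∈ : ∀ {A : Set} (xs : List A) {m : ℕ} (p : length xs ≡ m) (i : Fin m) →
  lookupAt xs p i ∈ xs
lookupAt-∈ (x ∷ xs) refl zero    = here refl
lookupAt-∈ (x ∷ xs) refl (suc i) = there (lookupAt-∈ xs refl i)

lookupAt-injective : ∀ {A : Set} (xs : List A) {m : ℕ} (p : length xs ≡ m) →
  AllPairs _≢_ xs → ∀ i j → lookupAt xs p i ≡ lookupAt xs p j → i ≡ j
lookupAt-injective (x ∷ xs) refl _          zero    zero    _  = refl
lookupAt-injective (x ∷ xs) refl (x∉xs ∷ _) zero    (suc j) eq =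
  ⊥-elim (All.lookup x∉xs (lookupAt-∈ xs refl j) eq)
lookupAt-injective (x ∷ xs) refl (x∉xs ∷ _) (suc i) zero    eq =
  ⊥-elim (All.lookup x∉xs (lookupAt-∈ xs refl i) (sym eq))
lookupAt-injective (x ∷ xs) refl (_ ∷ u)    (suc i) (suc j) eq =
  cong suc (lookupAt-injective xs refl u i j eq)

lookupAt-onto : ∀ {A : Set} (xs : List A) {m : ℕ} (p : length xs ≡ m) {w : A} →
  w ∈ xs → Σ (Fin m) λ i → lookupAt xs p i ≡ w
lookupAt-onto (x ∷ xs) refl (here refl) = zero , refl
lookupAt-onto (x ∷ xs) refl (there w∈xs) =
  let (i , eq) = lookupAt-onto xs refl w∈xs in suc i , eq

lookupAt-++ˡ : ∀ {A : Set} (xs ys : List A) {m : ℕ} (p : length (xs ++ ys) ≡ m) (i : Fin m) →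
  toℕ i < length xs → lookupAt (xs ++ ys) p i ∈ xs
lookupAt-++ˡ (x ∷ xs) ys refl zero    _         = here refl
lookupAt-++ˡ (x ∷ xs) ys refl (suc i) (s≤s i<) = there (lookupAt-++ˡ xs ys refl i i<)

lookupAt-++ʳ : ∀ {A : Set} (xs ys : List A) {m : ℕ} (p : length (xs ++ ys) ≡ m) (i : Fin m) →
  ¬ toℕ i < length xs → lookupAt (xs ++ ys) p i ∈ ys
lookupAt-++ʳ []       ys p    i       _  = lookupAt-∈ ys p i
lookupAt-++ʳ (x ∷ xs) ys refl zero    i≮ = ⊥-elim (i≮ (s≤s z≤n))
lookupAt-++ʳ (x ∷ xs) ys refl (suc i) i≮ = lookupAt-++ʳ xs ys refl i (i≮ ∘ s≤s)

distinct-length≤ : ∀ {n} (xs : List (Fin n)) → AllPairs _≢_ xs → length xs ≤ n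
distinct-length≤ xs distinct =
  FinP.injective⇒≤ (λ {i} {j} → lookupAt-injective xs refl distinct i j)

covering-length≥ : ∀ {n} (xs : List (Fin n)) → (∀ i → i ∈ xs) → n ≤ length xs
covering-length≥ xs mem =
  FinP.injective⇒≤ {f = Any.index ∘ mem} (λ {i} {j} → index-injective (setoid _) (mem i) (mem j))

module Walks (G : Graph) {P : Vtx G → Set} where
  open Graph G using (_~_) renaming (sym to ~-sym)

  reach-source : ∀ {a w} → Reach G P a w → P a
  reach-source (here pa)     = pa
  reach-source (step pa _ _) = pa

  reach-target : ∀ {a w} → Reach G P a w → P w
  reach-target (here pw)    = pw
  reach-target (step _ _ r) = reach-target r

  reach-snoc : ∀ {a w y} → Reach G P a w → w ~ y → P y → Reach G P a y
  reach-snoc (here pa)       ay py = step pa ay (here py)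
  reach-snoc (step pa ax r)  wy py = step pa ax (reach-snoc r wy py)

  reach-reverse : ∀ {a w} → Reach G P a w → Reach G P w a
  reach-reverse (here pa)      = here pa
  reach-reverse (step pa ax r) = reach-snoc (reach-reverse r) (~-sym ax) pa

  reach-trans : ∀ {a b c} → Reach G P a b → Reach G P b c → Reach G P a c
  reach-trans (here _)       r′ = r′
  reach-trans (step pa ax r) r′ = step pa ax (reach-trans r r′)

  reach-to-isolated : ∀ {t a} → (∀ w → t ~ w → ¬ P w) → Reach G P a t → a ≡ t
  reach-to-isolated isolated (here _) = refl
  reach-to-isolated isolated (step pa ax r) with reach-to-isolated isolated r
  ... | refl = ⊥-elim (isolated _ (~-sym ax) pa)

module Matchings (G : Graph) where
  open Graph G renaming (sym to ~-sym)

  V : Set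
  V = Vtx G

  Cov : List (Edge G) → V → Set
  Cov = Covered G

  Meets : Edge G → V → Set
  Meets e w = proj₁ e ≡ w ⊎ proj₂ e ≡ w

  EdgeIn : (V → Set) → Edge G → Set
  EdgeIn D e = proj₁ e ~ proj₂ e × D (proj₁ e) × D (proj₂ e)

  MatchingIn : (V → Set) → List (Edge G) → Set
  MatchingIn D L = All (EdgeIn D) L × AllPairs (Disjoint G) L

  MaximalIn : (V → Set) → List (Edge G) → Set
  MaximalIn D L = ∀ a b → D a → D b → a ~ b → Cov L a ⊎ Cov L b

  adjacent⇒distinct : ∀ {x y} → x ~ y → x ≢ y
  adjacent⇒distinct xy refl = irrefl xy

  covered? : ∀ L w → Dec (Cov L w)
  covered? L w = Any.any? (λ e → (proj₁ e ≟ w) ⊎-dec (proj₂ e ≟ w)) L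

  uncovered-∷⁺ : ∀ {a b L w} → a ≢ w → b ≢ w → ¬ Cov L w → ¬ Cov ((a , b) ∷ L) w
  uncovered-∷⁺ a≢w b≢w nw (here (inj₁ a≡w)) = a≢w a≡w
  uncovered-∷⁺ a≢w b≢w nw (here (inj₂ b≡w)) = b≢w b≡w
  uncovered-∷⁺ a≢w b≢w nw (there c)         = nw c

  uncovered-∷⁻ : ∀ {a b L w} → ¬ Cov ((a , b) ∷ L) w → a ≢ w × b ≢ w × ¬ Cov L w
  uncovered-∷⁻ nw = (λ a≡w → nw (here (inj₁ a≡w))) , (λ b≡w → nw (here (inj₂ b≡w))) , (λ c → nw (there c))

  uncovered-++ : ∀ L L′ {w} → ¬ Cov L w → ¬ Cov L′ w → ¬ Cov (L ++ L′) w
  uncovered-++ L L′ nw nw′ c = [ nw , nw′ ]′ (AnyP.++⁻ L c)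

  disjoint-meets : ∀ {e e′ w} → Disjoint G e e′ → Meets e w → ¬ Meets e′ w
  disjoint-meets (d₁ , _ , _ , _) (inj₁ refl) (inj₁ refl) = d₁ refl
  disjoint-meets (_ , d₂ , _ , _) (inj₁ refl) (inj₂ refl) = d₂ refl
  disjoint-meets (_ , _ , d₃ , _) (inj₂ refl) (inj₁ refl) = d₃ refl
  disjoint-meets (_ , _ , _ , d₄) (inj₂ refl) (inj₂ refl) = d₄ refl

  meets-disjoint : ∀ {e e′} → (∀ w → Meets e w → ¬ Meets e′ w) → Disjoint G e e′
  meets-disjoint apart =
    (λ eq → apart _ (inj₁ refl) (inj₁ (sym eq))) , (λ eq → apart _ (inj₁ refl) (inj₂ (sym eq))) ,
    (λ eq → apart _ (inj₂ refl) (inj₁ (sym eq))) , (λ eq → apart _ (inj₂ refl) (inj₂ (sym eq)))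

  disjoint-from-uncovered : ∀ {a b} L → ¬ Cov L a → ¬ Cov L b → All (Disjoint G (a , b)) L
  disjoint-from-uncovered L na nb = All.tabulate λ e∈L → meets-disjoint λ where
    _ (inj₁ refl) m → na (lose e∈L m)
    _ (inj₂ refl) m → nb (lose e∈L m)

  disjoint⇒uncovered : ∀ {e L w} → All (Disjoint G e) L → Meets e w → ¬ Cov L w
  disjoint⇒uncovered ds m c =
    let (_ , e′∈L , m′) = find c in disjoint-meets (All.lookup ds e′∈L) m m′

  covered-inside : ∀ {D L w} → All (EdgeIn D) L → Cov L w → D w
  covered-inside ins c with find c
  ... | _ , e∈L , inj₁ refl = proj₁ (proj₂ (All.lookup ins e∈L))
  ... | _ , e∈L , inj₂ refl = proj₂ (proj₂ (All.lookup ins e∈L))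

  partner : ∀ {D L w} → All (EdgeIn D) L → Cov L w → Σ V λ r → w ~ r × D r
  partner ins c with find c
  ... | _ , e∈L , inj₁ refl = let (ab , _ , Db) = All.lookup ins e∈L in _ , ab , Db
  ... | _ , e∈L , inj₂ refl = let (ab , Da , _) = All.lookup ins e∈L in _ , ~-sym ab , Da

  matchingIn-mono : ∀ {D D′ L} → (∀ {w} → D w → D′ w) → MatchingIn D L → MatchingIn D′ L
  matchingIn-mono D⊆D′ (ins , dis) = All.map (λ (ab , Da , Db) → ab , D⊆D′ Da , D⊆D′ Db) ins , dis

  matchingIn⇒matching : ∀ {D L} → MatchingIn D L → IsMatching G L
  matchingIn⇒matching (ins , dis) = All.map proj₁ ins , dis

  ++-matching : ∀ {L L′} → MatchingIn (NotCovered G L′) L → IsMatching G L′ → IsMatching G (L ++ L′)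
  ++-matching {L′ = L′} (ins , dis) (adj′ , dis′) =
    AllP.++⁺ (All.map proj₁ ins) adj′ ,
    AllPairsP.++⁺ dis dis′ (All.map (λ (_ , na , nb) → disjoint-from-uncovered L′ na nb) ins)

  module Greedy (D : V → Set) (D? : ∀ w → Dec (D w)) where
    Addable : List (Edge G) → Edge G → Set
    Addable L e = EdgeIn D e × ¬ Cov L (proj₁ e) × ¬ Cov L (proj₂ e)

    addable? : ∀ L e → Dec (Addable L e)
    addable? L e = (dec (proj₁ e) (proj₂ e) ×-dec D? (proj₁ e) ×-dec D? (proj₂ e))
                   ×-dec ¬? (covered? L (proj₁ e)) ×-dec ¬? (covered? L (proj₂ e))

    insert : Edge G → List (Edge G) → List (Edge G)
    insert e L with addable? L e
    ... | yes _ = e ∷ L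
    ... | no _  = L

    greedy : List (Edge G) → List (Edge G)
    greedy = foldr insert []

    insert-matching : ∀ e L → MatchingIn D L → MatchingIn D (insert e L)
    insert-matching e L (ins , dis) with addable? L e
    ... | yes (eD , na , nb) = eD ∷ ins , disjoint-from-uncovered L na nb ∷ dis
    ... | no _               = ins , dis

    insert-mono : ∀ e L {w} → Cov L w → Cov (insert e L) w
    insert-mono e L c with addable? L e
    ... | yes _ = there c
    ... | no _  = c

    insert-handles : ∀ e L → EdgeIn D e → Cov (insert e L) (proj₁ e) ⊎ Cov (insert e L) (proj₂ e)
    insert-handles e L eD with addable? L e
    ... | yes _ = inj₁ (here (inj₁ refl))
    ... | no ¬addable with covered? L (proj₁ e) | covered? L (proj₂ e)
    ...   | yes c | _     = inj₁ c
    ...   | no _  | yes c = inj₂ c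
    ...   | no na | no nb = ⊥-elim (¬addable (eD , na , nb))

    greedy-matching : ∀ es → MatchingIn D (greedy es)
    greedy-matching []       = [] , []
    greedy-matching (e ∷ es) = insert-matching e (greedy es) (greedy-matching es)

    greedy-handles : ∀ es {e} → e ∈ es → EdgeIn D e →
      Cov (greedy es) (proj₁ e) ⊎ Cov (greedy es) (proj₂ e)
    greedy-handles (e ∷ es) (here refl) eD = insert-handles e (greedy es) eD
    greedy-handles (e ∷ es) (there e∈) eD =
      Sum.map (insert-mono e (greedy es)) (insert-mono e (greedy es)) (greedy-handles es e∈ eD)

  maximalMatchingIn : (D : V → Set) → (∀ w → Dec (D w)) →
    Σ (List (Edge G)) λ L → MatchingIn D L × MaximalIn D L
  maximalMatchingIn D D? =
    greedy allEdges , greedy-matching allEdges ,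
    λ a b Da Db ab → greedy-handles allEdges (∈-cartesianProduct⁺ (∈-allFin a) (∈-allFin b)) (ab , Da , Db)
    where
    open Greedy D D?
    allEdges : List (Edge G)
    allEdges = cartesianProduct (allFin n) (allFin n)

  ends : List (Edge G) → List V
  ends Q = map proj₁ Q ++ map proj₂ Q

  ends-length : ∀ Q → length (ends Q) ≡ 2 * length Q
  ends-length Q = begin
    length (map proj₁ Q ++ map proj₂ Q)          ≡⟨ length-++ (map proj₁ Q) ⟩
    length (map proj₁ Q) + length (map proj₂ Q)  ≡⟨ cong₂ _+_ (length-map proj₁ Q) (length-map proj₂ Q) ⟩
    length Q + length Q                          ≡⟨ cong (length Q +_) (sym (ℕP.+-identityʳ (length Q))) ⟩
    2 * length Q                                 ∎
    where open ≡-Reasoning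

  ∈-ends⇒covered : ∀ Q {w} → w ∈ ends Q → Cov Q w
  ∈-ends⇒covered Q w∈ =
    [ Any.map (inj₁ ∘ sym) ∘ AnyP.map⁻ , Any.map (inj₂ ∘ sym) ∘ AnyP.map⁻ ]′ (AnyP.++⁻ (map proj₁ Q) w∈)

  covered⇒∈-ends : ∀ Q {w} → Cov Q w → w ∈ ends Q
  covered⇒∈-ends Q c =
    [ AnyP.++⁺ˡ ∘ AnyP.map⁺ ∘ Any.map sym , AnyP.++⁺ʳ (map proj₁ Q) ∘ AnyP.map⁺ ∘ Any.map sym ]′ (AnyP.Any-⊎⁻ c)

  uncovered-sides : ∀ Q {w} → ¬ Cov Q w → All (_≢ w) (map proj₁ Q) × All (_≢ w) (map proj₂ Q)
  uncovered-sides []      _  = [] , []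
  uncovered-sides (e ∷ Q) nw =
    let (s₁ , s₂) = uncovered-sides Q (λ c → nw (there c))
    in (λ eq → nw (here (inj₁ eq))) ∷ s₁ , (λ eq → nw (here (inj₂ eq))) ∷ s₂

  ends-cross : ∀ Q → IsMatching G Q → All (λ a → All (a ≢_) (map proj₂ Q)) (map proj₁ Q)
  ends-cross []            _                      = []
  ends-cross ((a , b) ∷ Q) (ab ∷ adj , ds ∷ dis) =
    (adjacent⇒distinct ab ∷ All.map (_∘ sym) (proj₂ (uncovered-sides Q (disjoint⇒uncovered ds (inj₁ refl))))) ∷
    All.zipWith (λ (a′≢b , rest) → a′≢b ∷ rest)
      (proj₁ (uncovered-sides Q (disjoint⇒uncovered ds (inj₂ refl))) , ends-cross Q (adj , dis))

  ends-distinct : ∀ {Q} → IsMatching G Q → AllPairs _≢_ (ends Q)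
  ends-distinct {Q} mat@(_ , dis) =
    AllPairsP.++⁺ (AllPairsP.map⁺ (AllPairs.map proj₁ dis))
                  (AllPairsP.map⁺ (AllPairs.map (proj₂ ∘ proj₂ ∘ proj₂) dis))
                  (ends-cross Q mat)

  endpoint : (Q : List (Edge G)) → Fin (2 * length Q) → V
  endpoint Q = lookupAt (ends Q) (ends-length Q)

  endpoint-injective : ∀ {Q} → IsMatching G Q → ∀ i j → endpoint Q i ≡ endpoint Q j → i ≡ j
  endpoint-injective {Q} mat = lookupAt-injective (ends Q) (ends-length Q) (ends-distinct mat)

  endpoint-covered : ∀ Q i → Cov Q (endpoint Q i)
  endpoint-covered Q i = ∈-ends⇒covered Q (lookupAt-∈ (ends Q) (ends-length Q) i)

  endpoint-onto : ∀ Q {w} → Cov Q w → Σ (Fin (2 * length Q)) λ i → endpoint Q i ≡ w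
  endpoint-onto Q c = lookupAt-onto (ends Q) (ends-length Q) (covered⇒∈-ends Q c)

  endpoint-first : ∀ Q i → toℕ i < length Q → endpoint Q i ∈ map proj₁ Q
  endpoint-first Q i i< =
    lookupAt-++ˡ (map proj₁ Q) (map proj₂ Q) (ends-length Q) i (subst (toℕ i <_) (sym (length-map proj₁ Q)) i<)

  endpoint-second : ∀ Q i → ¬ toℕ i < length Q → endpoint Q i ∈ map proj₂ Q
  endpoint-second Q i i≮ =
    lookupAt-++ʳ (map proj₁ Q) (map proj₂ Q) (ends-length Q) i (i≮ ∘ subst (toℕ i <_) (length-map proj₁ Q))

  perfectMatchingIso : (C : V → Set) {Q : List (Edge G)} → IsMatching G Q →
    (∀ {w} → C w → Cov Q w) → (∀ {w} → Cov Q w → C w) →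
    (R : Fin (2 * length Q) → Fin (2 * length Q) → Set) →
    (∀ i j → (endpoint Q i ~ endpoint Q j → R i j) × (R i j → endpoint Q i ~ endpoint Q j)) →
    InducedIso G C (2 * length Q) R
  perfectMatchingIso C {Q} mat perfect inside R adjacency =
    endpoint Q , endpoint-injective mat ,
    (λ w → (λ Cw → endpoint-onto Q (perfect Cw)) , λ { (i , refl) → inside (endpoint-covered Q i) }) ,
    adjacency

  module Orientation {X : V → Set} (X? : ∀ w → Dec (X w)) where
    orient : Edge G → Edge G
    orient e with X? (proj₁ e)
    ... | yes _ = swap e
    ... | no _  = e

    orient-meets : ∀ e {w} → Meets (orient e) w → Meets e w
    orient-meets e with X? (proj₁ e)
    ... | yes _ = Sum.swap
    ... | no _  = id

    meets-orient : ∀ e {w} → Meets e w → Meets (orient e) w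
    meets-orient e with X? (proj₁ e)
    ... | yes _ = Sum.swap
    ... | no _  = id

    orient-adjacent : ∀ e → proj₁ e ~ proj₂ e → proj₁ (orient e) ~ proj₂ (orient e)
    orient-adjacent e with X? (proj₁ e)
    ... | yes _ = ~-sym
    ... | no _  = id

    orient-matching : ∀ {L} → IsMatching G L → IsMatching G (map orient L)
    orient-matching (adj , dis) =
      AllP.map⁺ (All.map (orient-adjacent _) adj) ,
      AllPairsP.map⁺ (AllPairs.map (λ {e} {e′} d → meets-disjoint λ w m m′ →
        disjoint-meets d (orient-meets e m) (orient-meets e′ m′)) dis)

    orient-covered : ∀ L {w} → Cov (map orient L) w → Cov L w
    orient-covered L = Any.map (orient-meets _) ∘ AnyP.map⁻

    covered-orient : ∀ L {w} → Cov L w → Cov (map orient L) w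
    covered-orient L = AnyP.map⁺ ∘ Any.map (meets-orient _)

    OneSided : Edge G → Set
    OneSided e = (X (proj₁ e) ⊎ X (proj₂ e)) × ¬ (X (proj₁ e) × X (proj₂ e))

    orient-sides : ∀ e → OneSided e → ¬ X (proj₁ (orient e)) × X (proj₂ (orient e))
    orient-sides e (some , notBoth) with X? (proj₁ e)
    ... | yes x₁ = (λ x₂ → notBoth (x₁ , x₂)) , x₁
    ... | no ¬x₁ = ¬x₁ , [ (λ x₁ → ⊥-elim (¬x₁ x₁)) , id ]′ some

    oriented-first : ∀ {L w} → (∀ {e} → e ∈ L → OneSided e) → w ∈ map proj₁ (map orient L) → ¬ X w
    oriented-first oneSided w∈ with find (AnyP.map⁻ (AnyP.map⁻ w∈))
    ... | e , e∈L , refl = proj₁ (orient-sides e (oneSided e∈L))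

    oriented-second : ∀ {L w} → (∀ {e} → e ∈ L → OneSided e) → w ∈ map proj₂ (map orient L) → X w
    oriented-second oneSided w∈ with find (AnyP.map⁻ (AnyP.map⁻ w∈))
    ... | e , e∈L , refl = proj₂ (orient-sides e (oneSided e∈L))

-- In a factor-critical equimatchable graph a maximal matching N exposes at
-- most one vertex: if it exposed a ≠ b, then with M₀ a perfect matching of
-- G - a (which has at most |N| edges, as N is maximum by equimatchability)
--   2|N| + 2 ≤ |V(G)| ≤ 2|M₀| + 1 ≤ 2|N| + 1.
at-most-one-exposed : (G : Graph) → FactorCritical G → Equimatchable G →
  ∀ N → IsMaximal G N → ∀ {a b} → a ≢ b → ¬ Covered G N a → ¬ Covered G N b → ⊥
at-most-one-exposed G critical equimatchable N maximal {a} {b} a≢b na nb = ℕP.1+n≰n count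
  where
  open Matchings G

  M₀ : List (Edge G)
  M₀ = proj₁ (critical a)

  notIn : ∀ {w} → ¬ Cov N w → All (w ≢_) (ends N)
  notIn nw = AllP.¬Any⇒All¬ (ends N) (nw ∘ ∈-ends⇒covered N)

  distinct : AllPairs _≢_ (a ∷ b ∷ ends N)
  distinct = (a≢b ∷ notIn na) ∷ notIn nb ∷ ends-distinct (proj₁ maximal)

  exhaustive : ∀ w → w ∈ a ∷ ends M₀
  exhaustive w with w ≟ a
  ... | yes refl = here refl
  ... | no w≢a   = there (covered⇒∈-ends M₀ (proj₂ (proj₂ (proj₂ (critical a))) w w≢a))

  count : 2 + 2 * length N ≤ 1 + 2 * length N
  count = begin
    2 + 2 * length N         ≡⟨ cong (2 +_) (sym (ends-length N)) ⟩
    length (a ∷ b ∷ ends N)  ≤⟨ distinct-length≤ _ distinct ⟩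
    Graph.n G                ≤⟨ covering-length≥ _ exhaustive ⟩
    1 + length (ends M₀)     ≡⟨ cong (1 +_) (ends-length M₀) ⟩
    1 + 2 * length M₀        ≤⟨ ℕP.+-monoʳ-≤ 1 (ℕP.*-monoʳ-≤ 2 M₀≤N) ⟩
    1 + 2 * length N         ∎
    where
    open ℕP.≤-Reasoning
    M₀≤N : length M₀ ≤ length N
    M₀≤N = proj₂ (equimatchable N maximal) M₀ (proj₁ (proj₂ (critical a)))

module IsolatedVertex (G : Graph) (critical : FactorCritical G) (equimatchable : Equimatchable G)
  (M : List (Edge G)) (v : Vtx G) (M-matching : IsMatching G M) (M-isolates : Isolates G M v) where
  open Graph G renaming (sym to ~-sym)
  open Matchings G
  open Walks G

  U : V → Set
  U = NotCovered G M

  U? : ∀ w → Dec (U w)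
  U? w = ¬? (covered? M w)

  U-neighbour-not-v : ∀ {z y} → z ~ y → U y → z ≢ v
  U-neighbour-not-v zy Uy refl = Uy (proj₂ M-isolates _ zy)

  v-uncovered : ∀ {L} → All (EdgeIn U) L → ¬ Cov L v
  v-uncovered ins c = let (_ , vr , Ur) = partner ins c in U-neighbour-not-v vr Ur refl

  -- Otherwise extend L ∪ M to a maximal matching N
  -- greedily: N exposes both v and z, contradicting at-most-one-exposed.
  exposed-neighbour : ∀ L → MatchingIn U L → ∀ {z} → U z → z ≢ v → ¬ Cov L z →
    Σ V λ r → z ~ r × U r × ¬ Cov L r
  exposed-neighbour L L-in {z} Uz z≢v z∉L
    with FinP.any? (λ r → dec z r ×-dec U? r ×-dec ¬? (covered? L r))
  ... | yes found = found
  ... | no none =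
    ⊥-elim (at-most-one-exposed G critical equimatchable N (N-matching , N-maximal)
              (λ v≡z → z≢v (sym v≡z)) v-exposed z-exposed)
    where
    Base : List (Edge G)
    Base = L ++ M

    Exposed : V → Set
    Exposed = NotCovered G Base

    Exposed⊆U : ∀ {w} → Exposed w → U w
    Exposed⊆U nw c = nw (AnyP.++⁺ʳ L c)

    extension : Σ (List (Edge G)) λ X → MatchingIn Exposed X × MaximalIn Exposed X
    extension = maximalMatchingIn Exposed (λ w → ¬? (covered? Base w))

    X : List (Edge G)
    X = proj₁ extension

    X-in : MatchingIn Exposed X
    X-in = proj₁ (proj₂ extension)

    N : List (Edge G)
    N = X ++ Base

    N-matching : IsMatching G N
    N-matching = ++-matching X-in (++-matching L-in M-matching)

    N-maximal : ∀ a b → a ~ b → Cov N a ⊎ Cov N b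
    N-maximal a b ab with covered? Base a | covered? Base b
    ... | yes ca | _      = inj₁ (AnyP.++⁺ʳ X ca)
    ... | no _   | yes cb = inj₂ (AnyP.++⁺ʳ X cb)
    ... | no na  | no nb  = Sum.map AnyP.++⁺ˡ AnyP.++⁺ˡ (proj₂ (proj₂ extension) a b na nb ab)

    v-exposed : ¬ Cov N v
    v-exposed = uncovered-++ X Base (v-uncovered (proj₁ (matchingIn-mono Exposed⊆U X-in)))
                  (uncovered-++ L M (v-uncovered (proj₁ L-in)) (proj₁ M-isolates))

    -- an edge of X at z would lead to a neighbour of z exposed by L
    z∉X : ¬ Cov X z
    z∉X c = let (r , zr , Er) = partner (proj₁ X-in) c
            in none (r , zr , Exposed⊆U Er , λ r∈L → Er (AnyP.++⁺ˡ r∈L))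

    z-exposed : ¬ Cov N z
    z-exposed = uncovered-++ X Base z∉X (uncovered-++ L M z∉L Uz)

  Avoiding : List V → V → Set
  Avoiding ws w = U w × All (_≢ w) ws

  Avoiding? : ∀ ws w → Dec (Avoiding ws w)
  Avoiding? ws w = U? w ×-dec All.all? (λ x → ¬? (x ≟ w)) ws

  avoided : ∀ {ws L x} → All (EdgeIn (Avoiding ws)) L → x ∈ ws → ¬ Cov L x
  avoided ins x∈ws c = All.lookup (proj₂ (covered-inside ins c)) x∈ws refl

  -- Otherwise take a maximal matching
  -- L₀ of U - {a,b,c,d}; by (1) d has a neighbour r exposed by bc + L₀, and
  -- then r has a neighbour s exposed by ab + cd + L₀.  Both r and s avoid
  -- a, b, c, d and are exposed by L₀, contradicting maximality of L₀.
  close-path : ∀ {a b c d} → U a → U b → U c → U d → a ≢ c → b ≢ d → a ≢ d →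
    a ~ b → b ~ c → c ~ d → a ~ d
  close-path {a} {b} {c} {d} Ua Ub Uc Ud a≢c b≢d a≢d ab bc cd
    with dec a d | maximalMatchingIn (Avoiding (a ∷ b ∷ c ∷ d ∷ [])) (Avoiding? _)
  ... | yes ad  | _                         = ad
  ... | no ¬ad | L₀ , L₀-avoids , L₀-maximal =
    let (r , dr , Ur , r∉L₁) = exposed-neighbour L₁ L₁-in Ud (U-neighbour-not-v (~-sym cd) Uc) d∉L₁
    in  ⊥-elim (beyond-r r dr Ur r∉L₁)
    where
    L₀-in : MatchingIn U L₀
    L₀-in = matchingIn-mono proj₁ L₀-avoids

    a∉L₀ : ¬ Cov L₀ a
    a∉L₀ = avoided (proj₁ L₀-avoids) (here refl)
    b∉L₀ : ¬ Cov L₀ b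
    b∉L₀ = avoided (proj₁ L₀-avoids) (there (here refl))
    c∉L₀ : ¬ Cov L₀ c
    c∉L₀ = avoided (proj₁ L₀-avoids) (there (there (here refl)))
    d∉L₀ : ¬ Cov L₀ d
    d∉L₀ = avoided (proj₁ L₀-avoids) (there (there (there (here refl))))

    L₁ : List (Edge G)
    L₁ = (b , c) ∷ L₀

    L₁-in : MatchingIn U L₁
    L₁-in = (bc , Ub , Uc) ∷ proj₁ L₀-in , disjoint-from-uncovered L₀ b∉L₀ c∉L₀ ∷ proj₂ L₀-in

    d∉L₁ : ¬ Cov L₁ d
    d∉L₁ = uncovered-∷⁺ b≢d (adjacent⇒distinct cd) d∉L₀

    L₂ : List (Edge G)
    L₂ = (a , b) ∷ (c , d) ∷ L₀

    L₂-in : MatchingIn U L₂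
    L₂-in = (ab , Ua , Ub) ∷ (cd , Uc , Ud) ∷ proj₁ L₀-in ,
            ((a≢c , a≢d , adjacent⇒distinct bc , b≢d) ∷ disjoint-from-uncovered L₀ a∉L₀ b∉L₀) ∷
            disjoint-from-uncovered L₀ c∉L₀ d∉L₀ ∷ proj₂ L₀-in

    beyond-r : ∀ r → d ~ r → U r → ¬ Cov L₁ r → ⊥
    beyond-r r dr Ur r∉L₁ with uncovered-∷⁻ r∉L₁
    ... | b≢r , c≢r , r∉L₀ =
      let (s , rs , Us , s∉L₂) = exposed-neighbour L₂ L₂-in Ur (U-neighbour-not-v (~-sym dr) Ud)
                                   (uncovered-∷⁺ a≢r b≢r (uncovered-∷⁺ c≢r d≢r r∉L₀))
      in  beyond-s s rs Us s∉L₂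
      where
      a≢r : a ≢ r
      a≢r a≡r = ¬ad (subst (_~ d) (sym a≡r) (~-sym dr))
      d≢r : d ≢ r
      d≢r = adjacent⇒distinct dr

      beyond-s : ∀ s → r ~ s → U s → ¬ Cov L₂ s → ⊥
      beyond-s s rs Us s∉L₂ with uncovered-∷⁻ s∉L₂
      ... | a≢s , b≢s , s∉L₀′ with uncovered-∷⁻ s∉L₀′
      ...   | c≢s , d≢s , s∉L₀ =
        [ r∉L₀ , s∉L₀ ]′ (L₀-maximal r s (Ur , a≢r ∷ b≢r ∷ c≢r ∷ d≢r ∷ [])
                                          (Us , a≢s ∷ b≢s ∷ c≢s ∷ d≢s ∷ []) rs)

  WithinTwo : V → V → Set
  WithinTwo c w = c ≡ w ⊎ c ~ w ⊎ Σ V λ m → U m × c ~ m × m ~ w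

  withinTwo? : ∀ c w → Dec (WithinTwo c w)
  withinTwo? c w = (c ≟ w) ⊎-dec dec c w ⊎-dec FinP.any? (λ m → U? m ×-dec dec c m ×-dec dec m w)

  -- by (2), a path of length three through U can be shortcut
  withinTwo-step : ∀ {c w w′} → U c → U w → U w′ → WithinTwo c w → w ~ w′ → WithinTwo c w′
  withinTwo-step _ _  _ (inj₁ refl)      ww′ = inj₂ (inj₁ ww′)
  withinTwo-step _ Uw _ (inj₂ (inj₁ cw)) ww′ = inj₂ (inj₂ (_ , Uw , cw , ww′))
  withinTwo-step {c} {w} {w′} Uc Uw Uw′ (inj₂ (inj₂ (m , Um , cm , mw))) ww′
    with c ≟ w | m ≟ w′ | c ≟ w′
  ... | yes refl | _        | _         = inj₂ (inj₁ ww′)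
  ... | no _     | yes refl | _         = inj₂ (inj₁ cm)
  ... | no _     | no _     | yes c≡w′  = inj₁ c≡w′
  ... | no c≢w   | no m≢w′  | no c≢w′   = inj₂ (inj₁ (close-path Uc Um Uw Uw′ c≢w m≢w′ c≢w′ cm mw ww′))

  -- hence every component of U has diameter at most two
  reach⇒withinTwo : ∀ {c a w} → U c → WithinTwo c a → Reach G U a w → WithinTwo c w
  reach⇒withinTwo Uc near (here _)       = near
  reach⇒withinTwo Uc near (step Ua ax r) =
    reach⇒withinTwo Uc (withinTwo-step Uc Ua (reach-source r) near ax) r

  withinTwo⇒reach : ∀ {c w} → U c → U w → WithinTwo c w → Reach G U c w
  withinTwo⇒reach Uc Uw (inj₁ refl)                       = here Uw
  withinTwo⇒reach Uc Uw (inj₂ (inj₁ cw))                  = step Uc cw (here Uw)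
  withinTwo⇒reach Uc Uw (inj₂ (inj₂ (m , Um , cm , mw))) = step Uc cm (step Um mw (here Uw))

  module Component (u : V) (Uu : U u) (u≢v : u ≢ v) where
    C : V → Set
    C = Reach G U u

    C? : ∀ w → Dec (C w)
    C? w with U? w ×-dec withinTwo? u w
    ... | yes (Uw , near) = yes (withinTwo⇒reach Uu Uw near)
    ... | no ¬near        = no λ r → ¬near (reach-target r , reach⇒withinTwo Uu (inj₁ refl) r)

    C⊆U : ∀ {w} → C w → U w
    C⊆U = reach-target

    C-not-v : ∀ {w} → C w → w ≢ v
    C-not-v Cw refl = u≢v (reach-to-isolated (λ w vw Uw → Uw (proj₂ M-isolates w vw)) Cw)

    C-close : ∀ {x y} → C x → C y → WithinTwo x y
    C-close Cx Cy = reach⇒withinTwo (C⊆U Cx) (inj₁ refl) (reach-trans (reach-reverse Cx) Cy)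

    -- by (1), a maximal matching P of C is perfect
    module WithMatching (P : List (Edge G)) (P-in : MatchingIn C P) (P-maximal : MaximalIn C P) where
      P-matching : IsMatching G P
      P-matching = matchingIn⇒matching P-in

      P-inside : ∀ {w} → Cov P w → C w
      P-inside = covered-inside (proj₁ P-in)

      P-perfect : ∀ {w} → C w → Cov P w
      P-perfect {w} Cw with covered? P w
      ... | yes c = c
      ... | no w∉P =
        let (r , wr , Ur , r∉P) = exposed-neighbour P (matchingIn-mono C⊆U P-in) (C⊆U Cw) (C-not-v Cw) w∉P
        in  ⊥-elim ([ w∉P , r∉P ]′ (P-maximal w r Cw (reach-snoc Cw wr Ur) wr))

      Complete : Set
      Complete = ∀ {x y} → C x → C y → x ≢ y → x ~ y

      clique : Complete → Σ ℕ λ k → InducedIso G C (2 * k) (KAdj (2 * k))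
      clique complete = length P , perfectMatchingIso C P-matching P-perfect P-inside (KAdj _) adjacency
        where
        inC : ∀ i → C (endpoint P i)
        inC i = P-inside (endpoint-covered P i)

        adjacency : ∀ i j → (endpoint P i ~ endpoint P j → i ≢ j) × (i ≢ j → endpoint P i ~ endpoint P j)
        adjacency i j = (λ { a refl → irrefl a }) ,
                        λ i≢j → complete (inC i) (inC j) (i≢j ∘ endpoint-injective P-matching i j)

      -- x, z ∈ C distinct and non-adjacent: C is complete bipartite with sides
      -- "non-neighbours of x" (containing x, z) and "neighbours of x".
      module Bipartite (x z : V) (Cx : C x) (Cz : C z) (x≢z : x ≢ z) (¬xz : ¬ x ~ z) where
        x-neighbour : Σ V λ m → C m × x ~ m
        x-neighbour with C-close Cx Cz
        ... | inj₁ x≡z                     = ⊥-elim (x≢z x≡z)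
        ... | inj₂ (inj₁ xz)               = ⊥-elim (¬xz xz)
        ... | inj₂ (inj₂ (m , Um , xm , _)) = m , reach-snoc Cx xm Um , xm

        far-near : ∀ {a b} → C a → C b → ¬ x ~ a → x ~ b → a ~ b
        far-near {a} {b} Ca Cb ¬xa xb with a ≟ x | C-close Cx Ca
        ... | yes refl | _                  = xb
        ... | no a≢x   | inj₁ x≡a           = ⊥-elim (a≢x (sym x≡a))
        ... | no _     | inj₂ (inj₁ xa)     = ⊥-elim (¬xa xa)
        ... | no a≢x   | inj₂ (inj₂ (m , Um , xm , ma)) with m ≟ b
        ...   | yes refl = ~-sym ma
        ...   | no m≢b   = close-path (C⊆U Ca) Um (C⊆U Cx) (C⊆U Cb) a≢x m≢b (λ { refl → ¬xa xb })
                             (~-sym ma) (~-sym xm) xb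

        near-independent : ∀ {b b′} → C b → C b′ → x ~ b → x ~ b′ → ¬ b ~ b′
        near-independent {b} {b′} Cb Cb′ xb xb′ bb′ =
          ¬xz (close-path (C⊆U Cx) (C⊆U Cb) (C⊆U Cb′) (C⊆U Cz) (adjacent⇒distinct xb′)
                 (λ b≡z → adjacent⇒distinct zb (sym b≡z)) x≢z xb bb′ (~-sym zb′))
          where
          zb : z ~ b
          zb = far-near Cz Cb ¬xz xb
          zb′ : z ~ b′
          zb′ = far-near Cz Cb′ ¬xz xb′

        far-independent : ∀ {a a′} → C a → C a′ → ¬ x ~ a → ¬ x ~ a′ → ¬ a ~ a′
        far-independent Ca Ca′ ¬xa ¬xa′ aa′ with x-neighbour
        ... | m , Cm , xm =
          ¬xa′ (close-path (C⊆U Cx) (C⊆U Cm) (C⊆U Ca) (C⊆U Ca′) (λ { refl → ¬xa′ aa′ })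
                  (λ m≡a′ → ¬xa′ (subst (x ~_) m≡a′ xm)) (λ { refl → ¬xa (~-sym aa′) })
                  xm (~-sym (far-near Ca Cm ¬xa xm)) aa′)

        open Orientation (dec x)

        P-oneSided : ∀ {e} → e ∈ P → OneSided e
        P-oneSided {e} e∈P with All.lookup (proj₁ P-in) e∈P | dec x (proj₁ e) | dec x (proj₂ e)
        ... | ab , Ca , Cb | yes xa | yes xb = ⊥-elim (near-independent Ca Cb xa xb ab)
        ... | _            | yes xa | no ¬xb = inj₁ xa , λ (_ , xb) → ¬xb xb
        ... | _            | no ¬xa | yes xb = inj₂ xb , λ (xa , _) → ¬xa xa
        ... | ab , Ca , Cb | no ¬xa | no ¬xb = ⊥-elim (far-independent Ca Cb ¬xa ¬xb ab)

        -- P with every edge pointing from the far side to the near side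
        Q : List (Edge G)
        Q = map orient P

        k : ℕ
        k = length Q

        inC : ∀ i → C (endpoint Q i)
        inC i = P-inside (orient-covered P (endpoint-covered Q i))

        endpoint-far : ∀ i → toℕ i < k → ¬ x ~ endpoint Q i
        endpoint-far i i< = oriented-first P-oneSided (endpoint-first Q i i<)

        endpoint-near : ∀ i → ¬ toℕ i < k → x ~ endpoint Q i
        endpoint-near i i≮ = oriented-second P-oneSided (endpoint-second Q i i≮)

        adjacency : ∀ i j → (endpoint Q i ~ endpoint Q j → KBipAdj k i j) × (KBipAdj k i j → endpoint Q i ~ endpoint Q j)
        adjacency i j with toℕ i <? k | toℕ j <? k
        ... | yes i< | yes j< =
          (λ a → ⊥-elim (far-independent (inC i) (inC j) (endpoint-far i i<) (endpoint-far j j<) a)) ,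
          [ (λ (_ , j≮) → ⊥-elim (j≮ j<)) , (λ (i≮ , _) → ⊥-elim (i≮ i<)) ]′
        ... | yes i< | no j≮ =
          (λ _ → inj₁ (i< , j≮)) , λ _ → far-near (inC i) (inC j) (endpoint-far i i<) (endpoint-near j j≮)
        ... | no i≮ | yes j< =
          (λ _ → inj₂ (i≮ , j<)) , λ _ → ~-sym (far-near (inC j) (inC i) (endpoint-far j j<) (endpoint-near i i≮))
        ... | no i≮ | no j≮ =
          (λ a → ⊥-elim (near-independent (inC i) (inC j) (endpoint-near i i≮) (endpoint-near j j≮) a)) ,
          [ (λ (i< , _) → ⊥-elim (i≮ i<)) , (λ (_ , j<) → ⊥-elim (j≮ j<)) ]′

        bipartite : Σ ℕ λ k → InducedIso G C (2 * k) (KBipAdj k)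
        bipartite = k , perfectMatchingIso C (orient-matching P-matching) (covered-orient P ∘ P-perfect)
                          (P-inside ∘ orient-covered P) (KBipAdj k) adjacency

      complete-or-not : Complete ⊎ (Σ V λ x → Σ V λ z → C x × C z × x ≢ z × ¬ x ~ z)
      complete-or-not with FinP.any? (λ x → FinP.any? (λ z → C? x ×-dec C? z ×-dec ¬? (x ≟ z) ×-dec ¬? (dec x z)))
      ... | yes nonEdge = inj₂ nonEdge
      ... | no none     = inj₁ complete
        where
        complete : Complete
        complete {x} {y} Cx Cy x≢y with dec x y
        ... | yes xy = xy
        ... | no ¬xy = ⊥-elim (none (x , y , Cx , Cy , x≢y , ¬xy))

      classify : (Σ ℕ λ k → InducedIso G C (2 * k) (KAdj (2 * k))) ⊎ (Σ ℕ λ k → InducedIso G C (2 * k) (KBipAdj k))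
      classify with complete-or-not
      ... | inj₁ complete                           = inj₁ (clique complete)
      ... | inj₂ (x , z , Cx , Cz , x≢z , ¬xz) = inj₂ (Bipartite.bipartite x z Cx Cz x≢z ¬xz)

    classification : (Σ ℕ λ k → InducedIso G C (2 * k) (KAdj (2 * k))) ⊎ (Σ ℕ λ k → InducedIso G C (2 * k) (KBipAdj k))
    classification with maximalMatchingIn C C?
    ... | P , P-in , P-maximal = WithMatching.classify P P-in P-maximal

lemma4 : (G : Graph) → Connected G → FactorCritical G → Equimatchable G →
    ∀ v M → MinimalIsolating G M v →
    ∀ u → ¬ Covered G M u → u ≢ v →
    (Σ ℕ λ k → InducedIso G (Reach G (NotCovered G M) u) (2 * k) (KAdj (2 * k)))
    ⊎ (Σ ℕ λ k → InducedIso G (Reach G (NotCovered G M) u) (2 * k) (KBipAdj k))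
lemma4 G _ critical equimatchable v M (M-matching , M-isolates , _) u Uu u≢v =
  IsolatedVertex.Component.classification G critical equimatchable M v M-matching M-isolates u Uu u≢v
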